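{- There is no positive integer $n$ with $p^2(n,7)=44$; that is, no positive integer can be expressed as the sum of exactly $7$ positive squares in exactly $44$ ways.
   Context: $p^2(n,j)$ denotes the number of ways to write $n$ as a sum of exactly $j$ positive squares, up to order of summands. -}

module Defs where

open import Data.Nat using (ℕ; zero; suc; _+_; _*_; _≤?_; _≟_)
open import Data.List using (List; []; _∷_; map; concatMap; filter; length; sum; upTo)

-- All weakly decreasing lists of length j whose entries lie in {1,…,m}
-- (i.e. multisets of size j from {1,…,m}, listed in nonincreasing order).
decLists : ℕ → ℕ → List (List ℕ)
decLists zero    m = [] ∷ []
decLists (suc j) m =
  concatMap (λ k → map (λ xs → suc k ∷ xs) (decLists j (suc k))) (upTo m)

sumSq : List ℕ → ℕ
sumSq []       = 0
sumSq (x ∷ xs) = x * x + sumSq xs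

-- Each summand a² ≤ n forces 1 ≤ a ≤ n, so
-- enumerating multisets from {1,…,n} is exhaustive.
p2 : ℕ → ℕ → ℕ
p2 n j = length (filter (λ xs → sumSq xs ≟ n) (decLists j n))

module Submission where

-- For n ≥ 4900 there are at least 45 representations. Put q = ⌊√(n/4)⌋ and e = ⌊√(n − 2q²)⌋. Every
-- a ∈ (e, e + 5] and b ∈ [q, q + 8] occur as the two largest parts of a representation: b ≤ a, and
-- n − a² − b² lies between 34 and b², so it is a sum of five positive squares, each at most b. Indeed every
-- integer ≥ 34 is a sum of five positive squares, by Lagrange's four-square theorem (Euler's descent) and
-- the representations of 169 as a sum of one to five positive squares.
-- For n < 4900 the number of representations is computed, capped at 45.

open import Defs
open import Data.Nat using (ℕ; suc)
open import Relation.Binary.PropositionalEquality using (_≢_; trans; sym)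

module Arithmetic where
  open import Data.Nat
  open import Data.Nat.Properties
  open import Data.Nat.Tactic.RingSolver using (solve-∀)
  open import Data.Product using (∃-syntax; _×_; _,_)
  open import Data.Sum using (_⊎_; inj₁; inj₂)
  open import Relation.Nullary.Negation using (contradiction)
  open import Relation.Binary.PropositionalEquality

  m≤m*m : ∀ m → m ≤ m * m
  m≤m*m zero    = z≤n
  m≤m*m (suc m) = m≤m*n (suc m) (suc m)

  m*m≤n*n⇒m≤n : ∀ {m n} → m * m ≤ n * n → m ≤ n
  m*m≤n*n⇒m≤n m²≤n² = ≮⇒≥ (λ n<m → <⇒≱ (*-mono-< n<m n<m) m²≤n²)

  m*m<n*n⇒m<n : ∀ {m n} → m * m < n * n → m < n
  m*m<n*n⇒m<n m²<n² = ≰⇒> (λ n≤m → <⇒≱ m²<n² (*-mono-≤ n≤m n≤m))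

  m*m≡n*n⇒m≡n : ∀ {m n} → m * m ≡ n * n → m ≡ n
  m*m≡n*n⇒m≡n eq = ≤-antisym (m*m≤n*n⇒m≤n (≤-reflexive eq)) (m*m≤n*n⇒m≤n (≤-reflexive (sym eq)))

  m*m≡0⇒m≡0 : ∀ m → m * m ≡ 0 → m ≡ 0
  m*m≡0⇒m≡0 m eq with m*n≡0⇒m≡0∨n≡0 m eq
  ... | inj₁ m≡0 = m≡0
  ... | inj₂ m≡0 = m≡0

  +-≤-≡ : ∀ {a b c d} → a ≤ c → b ≤ d → a + b ≡ c + d → a ≡ c × b ≡ d
  +-≤-≡ a≤c b≤d eq with m≤n⇒m<n∨m≡n a≤c
  ... | inj₁ a<c  = contradiction eq (<⇒≢ (+-mono-<-≤ a<c b≤d))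
  ... | inj₂ refl = refl , +-cancelˡ-≡ _ _ _ eq

  even-or-odd : ∀ n → ∃[ h ] (n ≡ h + h ⊎ n ≡ suc (h + h))
  even-or-odd zero = 0 , inj₁ refl
  even-or-odd (suc n) with even-or-odd n
  ... | h , inj₁ refl = h , inj₂ refl
  ... | h , inj₂ refl = suc h , inj₁ (cong suc (sym (+-suc h h)))

  2h²+1<[2h+1]² : ∀ {h} → 0 < h → h * h + h * h + 1 < suc (h + h) * suc (h + h)
  2h²+1<[2h+1]² {h} 0<h =
    subst (h * h + h * h + 1 <_) (sym (expand h)) (m<m+n _ (≤-trans (*-monoʳ-< 4 0<h) (m≤n+m (4 * h) (2 * (h * h)))))
    where
    expand : ∀ h → suc (h + h) * suc (h + h) ≡ h * h + h * h + 1 + (2 * (h * h) + 4 * h)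
    expand = solve-∀

  ⌊√⌋-exists : ∀ k .{{_ : NonZero k}} n → ∃[ q ] k * (q * q) ≤ n × n < k * (suc q * suc q)
  ⌊√⌋-exists k zero    = 0 , subst (_≤ 0) (sym (*-zeroʳ k)) z≤n , subst (0 <_) (sym (*-identityʳ k)) (>-nonZero⁻¹ k)
  ⌊√⌋-exists k (suc n) with ⌊√⌋-exists k n
  ... | q , lo , hi with m≤n⇒m<n∨m≡n hi
  ...   | inj₁ 1+n<k[q+1]² = q , m≤n⇒m≤1+n lo , 1+n<k[q+1]²
  ...   | inj₂ 1+n≡k[q+1]² = suc q , ≤-reflexive (sym 1+n≡k[q+1]²) ,
          subst (_< k * (suc (suc q) * suc (suc q))) (sym 1+n≡k[q+1]²) (*-monoʳ-< k (*-mono-< (n<1+n (suc q)) (n<1+n (suc q))))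

  αq+β≤q² : ∀ {α β q₀ q} → α ≤ q₀ + q₀ → α * q₀ + β ≤ q₀ * q₀ → q₀ ≤ q → α * q + β ≤ q * q
  αq+β≤q² {α} {β} {q₀} α≤2q₀ αq₀+β≤q₀² q₀≤q with m≤n⇒∃[o]m+o≡n q₀≤q
  ... | t , refl = begin
    α * (q₀ + t) + β                  ≡⟨ linear α β q₀ t ⟩
    α * q₀ + β + α * t                ≤⟨ +-mono-≤ αq₀+β≤q₀² (*-monoˡ-≤ t α≤2q₀) ⟩
    q₀ * q₀ + (q₀ + q₀) * t           ≤⟨ m≤m+n _ (t * t) ⟩
    q₀ * q₀ + (q₀ + q₀) * t + t * t   ≡⟨ square q₀ t ⟨
    (q₀ + t) * (q₀ + t)               ∎
    where
    open ≤-Reasoning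
    linear : ∀ α β q₀ t → α * (q₀ + t) + β ≡ α * q₀ + β + α * t
    linear = solve-∀
    square : ∀ q₀ t → (q₀ + t) * (q₀ + t) ≡ q₀ * q₀ + (q₀ + q₀) * t + t * t
    square = solve-∀

module MinusOneModPrime where
  open import Data.Nat
  open import Data.Nat.Properties
  open import Data.Nat.DivMod using (_%_; _/_; m≡m%n+[m/n]*n; m%n<n)
  open import Data.Nat.Divisibility using (_∣_; divides; ∣⇒≤; ∣m+n∣m⇒∣n; n∣m*n)
  open import Data.Nat.Primality using (Prime; prime⇒nonZero; euclidsLemma)
  open import Data.Nat.Tactic.RingSolver using (solve-∀)
  open import Data.Fin using (toℕ; fromℕ<)
  open import Data.Fin.Properties using (pigeonhole; toℕ<n; toℕ-fromℕ<)
  open import Data.Product using (∃₂; _×_; _,_)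
  open import Data.Sum using (inj₁; inj₂)
  open import Relation.Nullary using (yes; no)
  open import Relation.Nullary.Negation using (contradiction)
  open import Relation.Binary.PropositionalEquality

  pigeonholeℕ : ∀ {m n} → m < n → (f : ℕ → ℕ) → (∀ i → f i < m) → ∃₂ λ i j → i < j × j < n × f i ≡ f j
  pigeonholeℕ m<n f f<m with pigeonhole m<n (λ i → fromℕ< (f<m (toℕ i)))
  ... | i , j , i<j , eq = toℕ i , toℕ j , i<j , toℕ<n j ,
    trans (sym (toℕ-fromℕ< (f<m (toℕ i)))) (trans (cong toℕ eq) (toℕ-fromℕ< (f<m (toℕ j))))

  concatAt : ℕ → (ℕ → ℕ) → (ℕ → ℕ) → ℕ → ℕ
  concatAt h F G i with i ≤? h
  ... | yes _ = F i
  ... | no  _ = G (i ∸ suc h)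

  module _ {h : ℕ} {F G : ℕ → ℕ} where

    concatAt-≤ : ∀ {i} → i ≤ h → concatAt h F G i ≡ F i
    concatAt-≤ {i} i≤h with i ≤? h
    ... | yes _   = refl
    ... | no  i≰h = contradiction i≤h i≰h

    concatAt-> : ∀ {i} → h < i → concatAt h F G i ≡ G (i ∸ suc h)
    concatAt-> {i} h<i with i ≤? h
    ... | yes i≤h = contradiction i≤h (<⇒≱ h<i)
    ... | no  _   = refl

    concatAt-< : ∀ {m} → (∀ i → F i < m) → (∀ i → G i < m) → ∀ i → concatAt h F G i < m
    concatAt-< F<m G<m i with ≤-<-connex i h
    ... | inj₁ i≤h = subst (_< _) (sym (concatAt-≤ i≤h)) (F<m i)
    ... | inj₂ h<i = subst (_< _) (sym (concatAt-> h<i)) (G<m (i ∸ suc h))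

  j∸[1+h]≤h : ∀ {h j} → j < suc h + suc h → h < j → j ∸ suc h ≤ h
  j∸[1+h]≤h {h} {j} j<2h+2 h<j = ≤-pred (subst (j ∸ suc h <_) (m+n∸m≡n (suc h) (suc h)) (∸-monoˡ-< j<2h+2 h<j))

  families-meet : ∀ {m} h (F G : ℕ → ℕ) → m < suc h + suc h → (∀ i → F i < m) → (∀ i → G i < m) →
                  (∀ {i j} → i < j → j ≤ h → F i ≢ F j) → (∀ {i j} → i < j → j ≤ h → G i ≢ G j) →
                  ∃₂ λ a b → a ≤ h × b ≤ h × F a ≡ G b
  families-meet h F G m<2h+2 F<m G<m F-injective G-injective
    with pigeonholeℕ m<2h+2 (concatAt h F G) (concatAt-< F<m G<m)
  ... | i , j , i<j , j<2h+2 , eq with ≤-<-connex j h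
  ...   | inj₁ j≤h = contradiction (trans (sym (concatAt-≤ (<⇒≤ (<-≤-trans i<j j≤h)))) (trans eq (concatAt-≤ j≤h)))
                                   (F-injective i<j j≤h)
  ...   | inj₂ h<j with ≤-<-connex i h
  ...     | inj₁ i≤h = i , j ∸ suc h , i≤h , j∸[1+h]≤h j<2h+2 h<j , trans (sym (concatAt-≤ i≤h)) (trans eq (concatAt-> h<j))
  ...     | inj₂ h<i = contradiction (trans (sym (concatAt-> h<i)) (trans eq (concatAt-> h<j)))
                                     (G-injective (∸-monoˡ-< i<j h<i) (j∸[1+h]≤h j<2h+2 h<j))

  module _ {p : ℕ} (p-prime : Prime p) where

    private instance
      p≢0 : NonZero p
      p≢0 = prime⇒nonZero p-prime

    %-≡⇒∣ : ∀ x y → x % p ≡ (x + y) % p → p ∣ y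
    %-≡⇒∣ x y eq = ∣m+n∣m⇒∣n (divides ((x + y) / p) (+-cancelˡ-≡ (x % p) _ _ (begin
      x % p + (x / p * p + y)         ≡⟨ +-assoc (x % p) _ y ⟨
      x % p + x / p * p + y           ≡⟨ cong (_+ y) (m≡m%n+[m/n]*n x p) ⟨
      x + y                           ≡⟨ m≡m%n+[m/n]*n (x + y) p ⟩
      (x + y) % p + (x + y) / p * p   ≡⟨ cong (_+ (x + y) / p * p) eq ⟨
      x % p + (x + y) / p * p         ∎))) (n∣m*n (x / p))
      where open ≡-Reasoning

    sq%-injective : ∀ {u v} → u < v → u + v < p → u * u % p ≢ v * v % p
    sq%-injective {u} {v} u<v u+v<p eq with euclidsLemma (v ∸ u) (u + v) p-prime p∣[v∸u][u+v]
      where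
      expand : ∀ u w → (u + w) * (u + w) ≡ u * u + w * (u + (u + w))
      expand = solve-∀
      v*v≡ : v * v ≡ u * u + (v ∸ u) * (u + v)
      v*v≡ = subst (λ t → t * t ≡ u * u + (v ∸ u) * (u + t)) (m+[n∸m]≡n (<⇒≤ u<v)) (expand u (v ∸ u))
      p∣[v∸u][u+v] : p ∣ (v ∸ u) * (u + v)
      p∣[v∸u][u+v] = %-≡⇒∣ (u * u) ((v ∸ u) * (u + v)) (trans eq (cong (_% p) v*v≡))
    ... | inj₁ p∣v∸u = <⇒≱ (≤-<-trans (m∸n≤m v u) (≤-<-trans (m≤n+m v u) u+v<p))
                           (∣⇒≤ {{>-nonZero (m<n⇒0<n∸m u<v)}} p∣v∸u)
    ... | inj₂ p∣u+v = <⇒≱ u+v<p (∣⇒≤ {{>-nonZero (<-≤-trans (≤-<-trans z≤n u<v) (m≤n+m v u))}} p∣u+v)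

  -- The h + 1 values a² mod p and the h + 1 values −1 − b² mod p (a, b ≤ h) cannot all be distinct.
  -1≡sum-of-two-squares : ∀ {h} → Prime (suc (h + h)) →
                          ∃₂ λ a b → a ≤ h × b ≤ h × suc (h + h) ∣ a * a + b * b + 1
  -1≡sum-of-two-squares {h} p-prime =
    fromMeeting (families-meet h F G p<2h+2 (λ a → m%n<n (a * a) p) G<p F-injective G-injective)
    where
    p = suc (h + h)
    F G : ℕ → ℕ
    F a = a * a % p
    G b = (h + h) ∸ b * b % p
    p<2h+2 : p < suc h + suc h
    p<2h+2 = s≤s (+-monoʳ-< h (n<1+n h))
    G<p : ∀ b → G b < p
    G<p b = s≤s (m∸n≤m (h + h) (b * b % p))
    F-injective : ∀ {i j} → i < j → j ≤ h → F i ≢ F j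
    F-injective i<j j≤h = sq%-injective p-prime i<j (s≤s (+-mono-≤ (≤-trans (<⇒≤ i<j) j≤h) j≤h))
    G-injective : ∀ {i j} → i < j → j ≤ h → G i ≢ G j
    G-injective {i} {j} i<j j≤h eq =
      F-injective i<j j≤h (∸-cancelˡ-≡ (≤-pred (m%n<n (i * i) p)) (≤-pred (m%n<n (j * j) p)) eq)
    fromMeeting : (∃₂ λ a b → a ≤ h × b ≤ h × F a ≡ G b) → ∃₂ λ a b → a ≤ h × b ≤ h × p ∣ a * a + b * b + 1
    fromMeeting (a , b , a≤h , b≤h , Fa≡Gb) = a , b , a≤h , b≤h , divides (suc (qa + qb)) (begin
      a * a + b * b + 1                 ≡⟨ cong₂ (λ x y → x + y + 1) (m≡m%n+[m/n]*n (a * a) p) (m≡m%n+[m/n]*n (b * b) p) ⟩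
      (A + qa * p) + (B + qb * p) + 1   ≡⟨ regroup A B qa qb p ⟩
      1 + (A + B) + (qa + qb) * p       ≡⟨ cong (λ t → 1 + t + (qa + qb) * p) A+B≡h+h ⟩
      suc (qa + qb) * p                 ∎)
      where
      open ≡-Reasoning
      A = a * a % p
      B = b * b % p
      qa = a * a / p
      qb = b * b / p
      regroup : ∀ A B qa qb p → (A + qa * p) + (B + qb * p) + 1 ≡ 1 + (A + B) + (qa + qb) * p
      regroup = solve-∀
      A+B≡h+h : A + B ≡ h + h
      A+B≡h+h = trans (cong (_+ B) Fa≡Gb) (m∸n+n≡m (≤-pred (m%n<n (b * b) p)))

module Lagrange where
  open import Data.Nat as ℕ using (ℕ; zero; suc; NonZero; z≤n; s≤s; z<s; n>1⇒nonTrivial)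
  import Data.Nat.Properties as ℕₚ
  import Data.Nat.Tactic.RingSolver as ℕSolver
  open import Data.Nat.Divisibility using (_∣_; divides)
  open import Data.Nat.Divisibility.Core using (hasNonTrivialDivisor)
  open import Data.Nat.Induction using (<-rec)
  open import Data.Nat.Primality using (Prime; Composite; prime?; prime⇒¬composite; prime⇒irreducible; ¬prime[1]; ¬prime⇒composite)
  open import Data.Integer using (ℤ; +_; +[1+_]; -[1+_]; _+_; _*_; -_; _-_; ∣_∣)
  import Data.Integer.Properties as ℤₚ
  open import Data.Integer.DivMod using (_/ℕ_; _%ℕ_; a≡a%ℕn+[a/ℕn]*n; n%ℕd<d)
  open import Data.Integer.Tactic.RingSolver using (solve; solve-∀)
  open import Data.List using ([]; _∷_)
  open import Data.Product using (∃₂; ∃-syntax; _×_; _,_; proj₁; proj₂)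
  open import Data.Sum using (_⊎_; inj₁; inj₂)
  open import Data.Empty using (⊥; ⊥-elim)
  open import Function using (_∘_)
  open import Relation.Nullary using (Dec; yes; no; ¬_)
  open import Relation.Binary.PropositionalEquality
  open Arithmetic using (m*m≡n*n⇒m≡n; m*m≡0⇒m≡0; +-≤-≡; even-or-odd; 2h²+1<[2h+1]²)
  open MinusOneModPrime using (-1≡sum-of-two-squares)

  record ℤ⁴ : Set where
    constructor ⟨_,_,_,_⟩
    field x₀ x₁ x₂ x₃ : ℤ
  open ℤ⁴

  infixl 6 _⊕_
  infixr 7 _·_
  infix  8 _⊙_ _⊛_

  -- The operations are INLINE so that the reflective ring solver sees through them.

  ‖_‖² : ℤ⁴ → ℤ
  ‖ x ‖² = x₀ x * x₀ x + x₁ x * x₁ x + x₂ x * x₂ x + x₃ x * x₃ x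
  {-# INLINE ‖_‖² #-}

  _⊙_ : ℤ⁴ → ℤ⁴ → ℤ
  x ⊙ y = x₀ x * x₀ y + x₁ x * x₁ y + x₂ x * x₂ y + x₃ x * x₃ y
  {-# INLINE _⊙_ #-}

  _⊕_ : ℤ⁴ → ℤ⁴ → ℤ⁴
  x ⊕ y = ⟨ x₀ x + x₀ y , x₁ x + x₁ y , x₂ x + x₂ y , x₃ x + x₃ y ⟩
  {-# INLINE _⊕_ #-}

  _·_ : ℤ → ℤ⁴ → ℤ⁴
  m · x = ⟨ m * x₀ x , m * x₁ x , m * x₂ x , m * x₃ x ⟩
  {-# INLINE _·_ #-}

  real : ℤ → ℤ⁴
  real r = ⟨ r , + 0 , + 0 , + 0 ⟩
  {-# INLINE real #-}

  -- the quaternion y x̄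
  _⊛_ : ℤ⁴ → ℤ⁴ → ℤ⁴
  x ⊛ y = ⟨ x ⊙ y
          , x₀ x * x₁ y - x₁ x * x₀ y + x₂ x * x₃ y - x₃ x * x₂ y
          , x₀ x * x₂ y - x₁ x * x₃ y - x₂ x * x₀ y + x₃ x * x₁ y
          , x₀ x * x₃ y + x₁ x * x₂ y - x₂ x * x₁ y - x₃ x * x₀ y ⟩
  {-# INLINE _⊛_ #-}

  ⟨⟩-cong : ∀ {a b c d a′ b′ c′ d′} → a ≡ a′ → b ≡ b′ → c ≡ c′ → d ≡ d′ →
            ⟨ a , b , c , d ⟩ ≡ ⟨ a′ , b′ , c′ , d′ ⟩
  ⟨⟩-cong refl refl refl refl = refl

  ‖⊛‖² : ∀ x y → ‖ x ⊛ y ‖² ≡ ‖ x ‖² * ‖ y ‖²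
  ‖⊛‖² ⟨ a , b , c , d ⟩ ⟨ e , f , g , h ⟩ = solve (a ∷ b ∷ c ∷ d ∷ e ∷ f ∷ g ∷ h ∷ [])

  ‖·‖² : ∀ m x → ‖ m · x ‖² ≡ m * m * ‖ x ‖²
  ‖·‖² m ⟨ a , b , c , d ⟩ = solve (m ∷ a ∷ b ∷ c ∷ d ∷ [])

  ‖⊕·‖² : ∀ m y k → ‖ y ⊕ m · k ‖² ≡ ‖ y ‖² + m * ((+ 2 · y) ⊙ k) + m * m * ‖ k ‖²
  ‖⊕·‖² m ⟨ a , b , c , d ⟩ ⟨ e , f , g , h ⟩ = solve (m ∷ a ∷ b ∷ c ∷ d ∷ e ∷ f ∷ g ∷ h ∷ [])

  ⊛-shift : ∀ m y k → (y ⊕ m · k) ⊛ y ≡ real ‖ y ‖² ⊕ m · (k ⊛ y)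
  ⊛-shift m ⟨ a , b , c , d ⟩ ⟨ e , f , g , h ⟩ = ⟨⟩-cong (solve vars) (solve vars) (solve vars) (solve vars)
    where vars = m ∷ a ∷ b ∷ c ∷ d ∷ e ∷ f ∷ g ∷ h ∷ []

  real-⊕-· : ∀ m r z → real (m * r) ⊕ m · z ≡ m · (real r ⊕ z)
  real-⊕-· m r ⟨ a , b , c , d ⟩ = ⟨⟩-cong (solve vars) (solve vars) (solve vars) (solve vars)
    where vars = m ∷ r ∷ a ∷ b ∷ c ∷ d ∷ []

  ‖⊕·‖²-divisible : ∀ m ε s y k → + 2 · y ≡ m · s → ‖ y ‖² ≡ m * m * ε →
                    ‖ y ⊕ m · k ‖² ≡ m * (m * (ε + s ⊙ k + ‖ k ‖²))
  ‖⊕·‖²-divisible m ε s@(⟨ s₀ , s₁ , s₂ , s₃ ⟩) y k@(⟨ k₀ , k₁ , k₂ , k₃ ⟩) 2y≡ms ‖y‖²≡m²ε = begin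
    ‖ y ⊕ m · k ‖²                                   ≡⟨ ‖⊕·‖² m y k ⟩
    ‖ y ‖² + m * ((+ 2 · y) ⊙ k) + m * m * ‖ k ‖²    ≡⟨ cong₂ (λ a t → a + m * (t ⊙ k) + m * m * ‖ k ‖²)
                                                                ‖y‖²≡m²ε 2y≡ms ⟩
    m * m * ε + m * ((m · s) ⊙ k) + m * m * ‖ k ‖²   ≡⟨ solve (m ∷ ε ∷ s₀ ∷ s₁ ∷ s₂ ∷ s₃ ∷ k₀ ∷ k₁ ∷ k₂ ∷ k₃ ∷ []) ⟩
    m * (m * (ε + s ⊙ k + ‖ k ‖²))                   ∎
    where open ≡-Reasoning

  balancedRem : ∀ x m .{{_ : NonZero m}} → ∃₂ λ y k → x ≡ y + + m * k × 2 ℕ.* ∣ y ∣ ℕ.≤ m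
  balancedRem x m with 2 ℕ.* (x %ℕ m) ℕ.≤? m
  ... | yes 2t≤m =
    + (x %ℕ m) , x /ℕ m , trans (a≡a%ℕn+[a/ℕn]*n x m) (cong (_+_ (+ (x %ℕ m))) (ℤₚ.*-comm (x /ℕ m) (+ m))) , 2t≤m
  ... | no  2t≰m = - + (m ℕ.∸ t) , q + + 1 , x≡ , bound
    where
    t = x %ℕ m
    q = x /ℕ m
    t≤m : t ℕ.≤ m
    t≤m = ℕₚ.<⇒≤ (n%ℕd<d x m)
    carry : ∀ t q m → t + q * m ≡ - (m - t) + m * (q + + 1)
    carry = solve-∀
    x≡ : x ≡ - + (m ℕ.∸ t) + + m * (q + + 1)
    x≡ = begin
      x                                  ≡⟨ a≡a%ℕn+[a/ℕn]*n x m ⟩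
      + t + q * + m                      ≡⟨ carry (+ t) q (+ m) ⟩
      - (+ m - + t) + + m * (q + + 1)    ≡⟨ cong (λ d → - d + + m * (q + + 1))
                                                     (trans (ℤₚ.m-n≡m⊖n m t) (ℤₚ.⊖-≥ t≤m)) ⟩
      - + (m ℕ.∸ t) + + m * (q + + 1)    ∎
      where open ≡-Reasoning
    bound : 2 ℕ.* ∣ - + (m ℕ.∸ t) ∣ ℕ.≤ m
    bound rewrite ℤₚ.∣-i∣≡∣i∣ (+ (m ℕ.∸ t)) = begin
      2 ℕ.* (m ℕ.∸ t)      ≡⟨ ℕₚ.*-distribˡ-∸ 2 m t ⟩
      2 ℕ.* m ℕ.∸ 2 ℕ.* t  ≤⟨ ℕₚ.∸-monoʳ-≤ (2 ℕ.* m) (ℕₚ.<⇒≤ (ℕₚ.≰⇒> 2t≰m)) ⟩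
      2 ℕ.* m ℕ.∸ m        ≡⟨ trans (ℕₚ.m+n∸m≡n m (m ℕ.+ 0)) (ℕₚ.+-identityʳ m) ⟩
      m                    ∎
      where open ℕₚ.≤-Reasoning

  record All⁴ (P : ℤ → Set) (x : ℤ⁴) : Set where
    constructor all⁴
    field
      p₀ : P (x₀ x)
      p₁ : P (x₁ x)
      p₂ : P (x₂ x)
      p₃ : P (x₃ x)

  balancedRem⁴ : ∀ x m .{{_ : NonZero m}} → ∃₂ λ y k → x ≡ y ⊕ + m · k × All⁴ (λ t → 2 ℕ.* ∣ t ∣ ℕ.≤ m) y
  balancedRem⁴ ⟨ a , b , c , d ⟩ m
    with balancedRem a m | balancedRem b m | balancedRem c m | balancedRem d m
  ... | ya , ka , a≡ , ba | yb , kb , b≡ , bb | yc , kc , c≡ , bc | yd , kd , d≡ , bd =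
    ⟨ ya , yb , yc , yd ⟩ , ⟨ ka , kb , kc , kd ⟩ , ⟨⟩-cong a≡ b≡ c≡ d≡ , all⁴ ba bb bc bd

  ‖_‖ℕ² : ℤ⁴ → ℕ
  ‖ x ‖ℕ² = ∣ x₀ x ∣ ℕ.* ∣ x₀ x ∣ ℕ.+ ∣ x₁ x ∣ ℕ.* ∣ x₁ x ∣
          ℕ.+ ∣ x₂ x ∣ ℕ.* ∣ x₂ x ∣ ℕ.+ ∣ x₃ x ∣ ℕ.* ∣ x₃ x ∣

  i*i≡+∣i∣*∣i∣ : ∀ i → i * i ≡ + (∣ i ∣ ℕ.* ∣ i ∣)
  i*i≡+∣i∣*∣i∣ (+ n)    = sym (ℤₚ.pos-* n n)
  i*i≡+∣i∣*∣i∣ -[1+ n ] = ℤₚ.+◃n≡+n _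

  ‖‖²≡+‖‖ℕ² : ∀ x → ‖ x ‖² ≡ + ‖ x ‖ℕ²
  ‖‖²≡+‖‖ℕ² ⟨ a , b , c , d ⟩ = begin
    a * a + b * b + c * c + d * d      ≡⟨ cong₂ _+_ (cong₂ _+_ (cong₂ _+_ (sq a) (sq b)) (sq c)) (sq d) ⟩
    + A + + B + + C + + D              ≡⟨ cong (λ t → t + + C + + D) (sym (ℤₚ.pos-+ A B)) ⟩
    + (A ℕ.+ B) + + C + + D            ≡⟨ cong (_+ + D) (sym (ℤₚ.pos-+ (A ℕ.+ B) C)) ⟩
    + (A ℕ.+ B ℕ.+ C) + + D            ≡⟨ sym (ℤₚ.pos-+ (A ℕ.+ B ℕ.+ C) D) ⟩
    + (A ℕ.+ B ℕ.+ C ℕ.+ D)            ∎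
    where
    open ≡-Reasoning
    sq = i*i≡+∣i∣*∣i∣
    A = ∣ a ∣ ℕ.* ∣ a ∣
    B = ∣ b ∣ ℕ.* ∣ b ∣
    C = ∣ c ∣ ℕ.* ∣ c ∣
    D = ∣ d ∣ ℕ.* ∣ d ∣

  All⁴-map : ∀ {P Q : ℤ → Set} → (∀ {t} → P t → Q t) → ∀ {y} → All⁴ P y → All⁴ Q y
  All⁴-map f (all⁴ a b c d) = all⁴ (f a) (f b) (f c) (f d)

  module _ {m : ℕ} where

    private
      four-times : ∀ a b c d → (2 ℕ.* a) ℕ.* (2 ℕ.* a) ℕ.+ (2 ℕ.* b) ℕ.* (2 ℕ.* b)
                                 ℕ.+ (2 ℕ.* c) ℕ.* (2 ℕ.* c) ℕ.+ (2 ℕ.* d) ℕ.* (2 ℕ.* d)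
                               ≡ 4 ℕ.* (a ℕ.* a ℕ.+ b ℕ.* b ℕ.+ c ℕ.* c ℕ.+ d ℕ.* d)
      four-times = ℕSolver.solve-∀

      four-copies : ∀ n → n ℕ.+ n ℕ.+ n ℕ.+ n ≡ 4 ℕ.* n
      four-copies = ℕSolver.solve-∀

      sq-mono : ∀ u → 2 ℕ.* u ℕ.≤ m → (2 ℕ.* u) ℕ.* (2 ℕ.* u) ℕ.≤ m ℕ.* m
      sq-mono _ le = ℕₚ.*-mono-≤ le le

    ‖‖ℕ²-bound : ∀ y → All⁴ (λ t → 2 ℕ.* ∣ t ∣ ℕ.≤ m) y → ‖ y ‖ℕ² ℕ.≤ m ℕ.* m
    ‖‖ℕ²-bound ⟨ a , b , c , d ⟩ (all⁴ ba bb bc bd) =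
      ℕₚ.*-cancelˡ-≤ 4 (subst₂ ℕ._≤_ (four-times (∣ a ∣) (∣ b ∣) (∣ c ∣) (∣ d ∣)) (four-copies (m ℕ.* m))
        (ℕₚ.+-mono-≤ (ℕₚ.+-mono-≤ (ℕₚ.+-mono-≤ (sq-mono (∣ a ∣) ba) (sq-mono (∣ b ∣) bb)) (sq-mono (∣ c ∣) bc))
                     (sq-mono (∣ d ∣) bd)))

    ‖‖ℕ²-max : ∀ y → All⁴ (λ t → 2 ℕ.* ∣ t ∣ ℕ.≤ m) y → ‖ y ‖ℕ² ≡ m ℕ.* m →
               All⁴ (λ t → 2 ℕ.* ∣ t ∣ ≡ m) y
    ‖‖ℕ²-max ⟨ a , b , c , d ⟩ (all⁴ ba bb bc bd) eq =
      all⁴ (m*m≡n*n⇒m≡n (proj₁ ab)) (m*m≡n*n⇒m≡n (proj₂ ab)) (m*m≡n*n⇒m≡n (proj₂ abc)) (m*m≡n*n⇒m≡n (proj₂ abcd))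
      where
      a² = sq-mono (∣ a ∣) ba
      b² = sq-mono (∣ b ∣) bb
      c² = sq-mono (∣ c ∣) bc
      d² = sq-mono (∣ d ∣) bd
      abcd = +-≤-≡ (ℕₚ.+-mono-≤ (ℕₚ.+-mono-≤ a² b²) c²) d²
               (trans (four-times (∣ a ∣) (∣ b ∣) (∣ c ∣) (∣ d ∣)) (trans (cong (4 ℕ.*_) eq) (sym (four-copies (m ℕ.* m)))))
      abc = +-≤-≡ (ℕₚ.+-mono-≤ a² b²) c² (proj₁ abcd)
      ab = +-≤-≡ a² b² (proj₁ abc)

  ‖‖ℕ²-zero : ∀ y → ‖ y ‖ℕ² ≡ 0 → All⁴ (λ t → ∣ t ∣ ≡ 0) y
  ‖‖ℕ²-zero ⟨ a , b , c , d ⟩ eq =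
    all⁴ (m*m≡0⇒m≡0 (∣ a ∣) (m+n≡0⇒m≡0 A ab≡0))
         (m*m≡0⇒m≡0 (∣ b ∣) (m+n≡0⇒n≡0 A ab≡0))
         (m*m≡0⇒m≡0 (∣ c ∣) (m+n≡0⇒n≡0 (A ℕ.+ B) abc≡0))
         (m*m≡0⇒m≡0 (∣ d ∣) (m+n≡0⇒n≡0 (A ℕ.+ B ℕ.+ C) eq))
    where
    open ℕₚ using (m+n≡0⇒m≡0; m+n≡0⇒n≡0)
    A = ∣ a ∣ ℕ.* ∣ a ∣
    B = ∣ b ∣ ℕ.* ∣ b ∣
    C = ∣ c ∣ ℕ.* ∣ c ∣
    abc≡0 = m+n≡0⇒m≡0 (A ℕ.+ B ℕ.+ C) eq
    ab≡0 = m+n≡0⇒m≡0 (A ℕ.+ B) abc≡0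

  halfMultiple : ∀ {m} t → ∣ t ∣ ≡ 0 ⊎ 2 ℕ.* ∣ t ∣ ≡ m → ∃[ s ] + 2 * t ≡ + m * s
  halfMultiple {m} (+ zero) _             = + 0 , sym (ℤₚ.*-zeroʳ (+ m))
  halfMultiple {m} +[1+ u ] (inj₂ 2u≡m) =
    + 1 , trans (sym (ℤₚ.pos-* 2 (suc u))) (trans (cong +_ 2u≡m) (sym (ℤₚ.*-identityʳ (+ m))))
  halfMultiple {m} -[1+ u ] (inj₂ 2u≡m) = - + 1 , (begin
    + 2 * -[1+ u ]          ≡⟨ sym (ℤₚ.neg-distribʳ-* (+ 2) (+ suc u)) ⟩
    - (+ 2 * + suc u)       ≡⟨ cong -_ (sym (ℤₚ.pos-* 2 (suc u))) ⟩
    - + (2 ℕ.* suc u)       ≡⟨ cong (λ n → - + n) 2u≡m ⟩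
    - + m                   ≡⟨ cong -_ (sym (ℤₚ.*-identityʳ (+ m))) ⟩
    - (+ m * + 1)           ≡⟨ ℤₚ.neg-distribʳ-* (+ m) (+ 1) ⟩
    + m * - + 1             ∎)
    where open ≡-Reasoning

  halfMultiple⁴ : ∀ {m} y → All⁴ (λ t → ∣ t ∣ ≡ 0 ⊎ 2 ℕ.* ∣ t ∣ ≡ m) y → ∃[ s ] + 2 · y ≡ + m · s
  halfMultiple⁴ ⟨ a , b , c , d ⟩ (all⁴ ha hb hc hd)
    with halfMultiple a ha | halfMultiple b hb | halfMultiple c hc | halfMultiple d hd
  ... | sa , ea | sb , eb | sc , ec | sd , ed = ⟨ sa , sb , sc , sd ⟩ , ⟨⟩-cong ea eb ec ed

  FourSquares : ℤ → Set
  FourSquares n = ∃[ x ] ‖ x ‖² ≡ n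

  FourSquares-* : ∀ {a b} → FourSquares a → FourSquares b → FourSquares (a * b)
  FourSquares-* (x , ‖x‖²≡a) (y , ‖y‖²≡b) = x ⊛ y , trans (‖⊛‖² x y) (cong₂ _*_ ‖x‖²≡a ‖y‖²≡b)

  -- With x = y + m k and ‖y‖² = m r, every coordinate of x ⊛ y is divisible by m, and dividing Euler's
  -- identity ‖x ⊛ y‖² = ‖x‖² ‖y‖² = m P · m r by m² represents r P.
  ‖real⊕⊛‖² : ∀ m .{{_ : NonZero m}} r P y k → ‖ y ⊕ + m · k ‖² ≡ + m * P → ‖ y ‖² ≡ + m * r →
              ‖ real r ⊕ k ⊛ y ‖² ≡ r * P
  ‖real⊕⊛‖² m r P y k ‖x‖²≡mP ‖y‖²≡mr =
    sym (ℤₚ.*-cancelˡ-≡ (+ m) _ _ (ℤₚ.*-cancelˡ-≡ (+ m) _ _ (begin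
      M * (M * (r * P))                       ≡⟨ rearrange M r P ⟩
      (M * P) * (M * r)                       ≡⟨ cong₂ _*_ ‖x‖²≡mP ‖y‖²≡mr ⟨
      ‖ y ⊕ M · k ‖² * ‖ y ‖²                 ≡⟨ ‖⊛‖² (y ⊕ M · k) y ⟨
      ‖ (y ⊕ M · k) ⊛ y ‖²                    ≡⟨ cong ‖_‖² (⊛-shift M y k) ⟩
      ‖ real ‖ y ‖² ⊕ M · (k ⊛ y) ‖²          ≡⟨ cong (λ t → ‖ real t ⊕ M · (k ⊛ y) ‖²) ‖y‖²≡mr ⟩
      ‖ real (M * r) ⊕ M · (k ⊛ y) ‖²         ≡⟨ cong ‖_‖² (real-⊕-· M r (k ⊛ y)) ⟩
      ‖ M · (real r ⊕ k ⊛ y) ‖²               ≡⟨ ‖·‖² M (real r ⊕ k ⊛ y) ⟩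
      M * M * ‖ real r ⊕ k ⊛ y ‖²             ≡⟨ ℤₚ.*-assoc M M _ ⟩
      M * (M * ‖ real r ⊕ k ⊛ y ‖²)           ∎)))
    where
    open ≡-Reasoning
    M = + m
    rearrange : ∀ a b c → a * (a * (b * c)) ≡ (a * c) * (a * b)
    rearrange = solve-∀

  module Descent {p : ℕ} (p-prime : Prime p) where

    private
      m∤p : ∀ {m} → 1 ℕ.< m → m ℕ.< p → ¬ (m ∣ p)
      m∤p 1<m m<p m∣p = prime⇒¬composite p-prime (hasNonTrivialDivisor {{n>1⇒nonTrivial 1<m}} m<p m∣p)

    -- When ‖y‖² is 0 or m², every residue is 0 or ±m/2; then m² divides ‖x‖² = m p, so m divides p.
    degenerate : ∀ {m} → 1 ℕ.< m → m ℕ.< p → ∀ y k ε → ‖ y ⊕ + m · k ‖² ≡ + m * + p →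
                 All⁴ (λ t → ∣ t ∣ ≡ 0 ⊎ 2 ℕ.* ∣ t ∣ ≡ m) y → ‖ y ‖² ≡ + m * + m * ε → ⊥
    degenerate {m@(suc _)} 1<m m<p y k ε ‖x‖²≡mp halves ‖y‖²≡m²ε with halfMultiple⁴ y halves
    ... | s , 2y≡ms = m∤p 1<m m<p (divides ∣ T ∣ p≡∣T∣m)
      where
      T = ε + s ⊙ k + ‖ k ‖²
      p≡mT : + p ≡ + m * T
      p≡mT = ℤₚ.*-cancelˡ-≡ (+ m) (+ p) (+ m * T)
               (trans (sym ‖x‖²≡mp) (‖⊕·‖²-divisible (+ m) ε s y k 2y≡ms ‖y‖²≡m²ε))
      p≡∣T∣m : p ≡ ∣ T ∣ ℕ.* m
      p≡∣T∣m = trans (cong ∣_∣ p≡mT) (trans (ℤₚ.abs-* (+ m) T) (ℕₚ.*-comm m ∣ T ∣))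

    descent-step : ∀ {m} → 1 ℕ.< m → m ℕ.< p → ∀ x → ‖ x ‖² ≡ + m * + p →
                   ∃[ r ] 0 ℕ.< r × r ℕ.< m × FourSquares (+ r * + p)
    descent-step {m@(suc _)} 1<m m<p x ‖x‖²≡mp with balancedRem⁴ x m
    ... | y , k , refl , balanced = classify ∣ R ∣ ‖y‖ℕ²≡m∣R∣ ‖y‖²≡m∣R∣ ∣R∣≤m
      where
      R = + p - (+ 2 · y) ⊙ k - + m * ‖ k ‖²
      ‖y‖²≡mR : ‖ y ‖² ≡ + m * R
      ‖y‖²≡mR = begin
        ‖ y ‖²                                 ≡⟨ cancel ‖ y ‖² W K M ⟩
        ‖ y ‖² + M * W + M * M * K - M * W - M * M * K
                                               ≡⟨ cong (λ t → t - M * W - M * M * K)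
                                                       (trans (sym (‖⊕·‖² M y k)) ‖x‖²≡mp) ⟩
        M * + p - M * W - M * M * K            ≡⟨ factor M (+ p) W K ⟩
        M * R                                  ∎
        where
        open ≡-Reasoning
        M = + m
        W = (+ 2 · y) ⊙ k
        K = ‖ k ‖²
        cancel : ∀ a w κ m → a ≡ a + m * w + m * m * κ - m * w - m * m * κ
        cancel = solve-∀
        factor : ∀ m q w κ → m * q - m * w - m * m * κ ≡ m * (q - w - m * κ)
        factor = solve-∀
      ‖y‖ℕ²≡m∣R∣ : ‖ y ‖ℕ² ≡ m ℕ.* ∣ R ∣
      ‖y‖ℕ²≡m∣R∣ = trans (cong ∣_∣ (trans (sym (‖‖²≡+‖‖ℕ² y)) ‖y‖²≡mR)) (ℤₚ.abs-* (+ m) R)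
      ‖y‖²≡m∣R∣ : ‖ y ‖² ≡ + m * + ∣ R ∣
      ‖y‖²≡m∣R∣ = trans (‖‖²≡+‖‖ℕ² y) (trans (cong +_ ‖y‖ℕ²≡m∣R∣) (ℤₚ.pos-* m ∣ R ∣))
      ∣R∣≤m : ∣ R ∣ ℕ.≤ m
      ∣R∣≤m = ℕₚ.*-cancelˡ-≤ m (subst (ℕ._≤ m ℕ.* m) ‖y‖ℕ²≡m∣R∣ (‖‖ℕ²-bound y balanced))
      classify : ∀ r → ‖ y ‖ℕ² ≡ m ℕ.* r → ‖ y ‖² ≡ + m * + r → r ℕ.≤ m →
                 ∃[ r ] 0 ℕ.< r × r ℕ.< m × FourSquares (+ r * + p)
      classify zero ‖y‖ℕ²≡0 ‖y‖²≡0 _ = ⊥-elim (degenerate 1<m m<p y k (+ 0) ‖x‖²≡mp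
        (All⁴-map inj₁ (‖‖ℕ²-zero y (trans ‖y‖ℕ²≡0 (ℕₚ.*-zeroʳ m))))
        (trans ‖y‖²≡0 (trans (ℤₚ.*-zeroʳ (+ m)) (sym (ℤₚ.*-zeroʳ (+ m * + m))))))
      classify (suc r) ‖y‖ℕ²≡mr ‖y‖²≡mr r≤m with ℕₚ.m≤n⇒m<n∨m≡n r≤m
      ... | inj₁ r<m =
        suc r , z<s , r<m , real (+ suc r) ⊕ k ⊛ y , ‖real⊕⊛‖² m (+ suc r) (+ p) y k ‖x‖²≡mp ‖y‖²≡mr
      ... | inj₂ refl = ⊥-elim (degenerate 1<m m<p y k (+ 1) ‖x‖²≡mp
        (All⁴-map inj₂ (‖‖ℕ²-max y balanced ‖y‖ℕ²≡mr)) (trans ‖y‖²≡mr (sym (ℤₚ.*-identityʳ (+ m * + m)))))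

    fromMultiple : ∀ m → 0 ℕ.< m → m ℕ.< p → FourSquares (+ m * + p) → FourSquares (+ p)
    fromMultiple = <-rec _ step
      where
      step : ∀ m → (∀ {r} → r ℕ.< m → 0 ℕ.< r → r ℕ.< p → FourSquares (+ r * + p) → FourSquares (+ p)) →
             0 ℕ.< m → m ℕ.< p → FourSquares (+ m * + p) → FourSquares (+ p)
      step 1 _ _ _ (x , ‖x‖²≡p) = x , trans ‖x‖²≡p (ℤₚ.*-identityˡ (+ p))
      step (suc (suc m)) rec _ m<p (x , ‖x‖²≡mp) with descent-step (s≤s (s≤s z≤n)) m<p x ‖x‖²≡mp
      ... | r , 0<r , r<m , sum = rec r<m 0<r (ℕₚ.<-trans r<m m<p) sum

  FourSquares-prime : ∀ {p} → Prime p → FourSquares (+ p)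
  FourSquares-prime {p} p-prime with even-or-odd p
  ... | h , inj₁ refl with prime⇒irreducible p-prime 2∣h+h
    where
    2∣h+h : 2 ∣ h ℕ.+ h
    2∣h+h = divides h (trans (cong (h ℕ.+_) (sym (ℕₚ.+-identityʳ h))) (ℕₚ.*-comm 2 h))
  ...   | inj₂ 2≡p = subst (FourSquares ∘ +_) 2≡p (⟨ + 1 , + 1 , + 0 , + 0 ⟩ , refl)
  FourSquares-prime {p} p-prime | zero , inj₂ refl = ⊥-elim (¬prime[1] p-prime)
  FourSquares-prime {p} p-prime | h@(suc _) , inj₂ refl = fromCongruence (-1≡sum-of-two-squares p-prime)
    where
    fromCongruence : (∃₂ λ a b → a ℕ.≤ h × b ℕ.≤ h × p ∣ a ℕ.* a ℕ.+ b ℕ.* b ℕ.+ 1) → FourSquares (+ p)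
    fromCongruence (a , b , a≤h , b≤h , divides zero a²+b²+1≡0) =
      ⊥-elim (ℕₚ.1+n≢0 (trans (ℕₚ.+-comm 1 _) a²+b²+1≡0))
    fromCongruence (a , b , a≤h , b≤h , divides (suc m) a²+b²+1≡mp) =
      Descent.fromMultiple p-prime (suc m) z<s m<p (⟨ + a , + b , + 1 , + 0 ⟩ , ‖‖²≡mp)
      where
      m<p : suc m ℕ.< p
      m<p = ℕₚ.*-cancelʳ-< p (suc m) p (begin-strict
        suc m ℕ.* p                       ≡⟨ a²+b²+1≡mp ⟨
        a ℕ.* a ℕ.+ b ℕ.* b ℕ.+ 1         ≤⟨ ℕₚ.+-monoˡ-≤ 1 (ℕₚ.+-mono-≤ (ℕₚ.*-mono-≤ a≤h a≤h)
                                                                         (ℕₚ.*-mono-≤ b≤h b≤h)) ⟩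
        h ℕ.* h ℕ.+ h ℕ.* h ℕ.+ 1         <⟨ 2h²+1<[2h+1]² z<s ⟩
        p ℕ.* p                           ∎)
        where open ℕₚ.≤-Reasoning
      ‖‖²≡mp : ‖ ⟨ + a , + b , + 1 , + 0 ⟩ ‖² ≡ + suc m * + p
      ‖‖²≡mp = trans (‖‖²≡+‖‖ℕ² ⟨ + a , + b , + 1 , + 0 ⟩)
                     (trans (cong +_ (trans (ℕₚ.+-identityʳ _) a²+b²+1≡mp)) (ℤₚ.pos-* (suc m) p))

  FourSquares-ℕ : ∀ n → FourSquares (+ n)
  FourSquares-ℕ = <-rec _ step
    where
    step : ∀ n → (∀ {m} → m ℕ.< n → FourSquares (+ m)) → FourSquares (+ n)
    step 0 _ = ⟨ + 0 , + 0 , + 0 , + 0 ⟩ , refl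
    step 1 _ = ⟨ + 1 , + 0 , + 0 , + 0 ⟩ , refl
    step n@(suc (suc _)) rec = byPrimality (prime? n)
      where
      fromFactors : Composite n → FourSquares (+ n)
      fromFactors (hasNonTrivialDivisor {d} d<n (divides q@(suc _) n≡qd)) =
        subst (FourSquares ∘ +_) (sym n≡qd) (subst FourSquares (sym (ℤₚ.pos-* q d)) (FourSquares-* (rec q<n) (rec d<n)))
        where
        q<n : q ℕ.< n
        q<n = subst (q ℕ.<_) (sym n≡qd) (ℕₚ.m<m*n q d (ℕ.nonTrivial⇒n>1 d))
      byPrimality : Dec (Prime n) → FourSquares (+ n)
      byPrimality (yes n-prime) = FourSquares-prime n-prime
      byPrimality (no ¬n-prime) = fromFactors (¬prime⇒composite ¬n-prime)

  lagrange : ∀ n → ∃[ a ] ∃[ b ] ∃[ c ] ∃[ d ] a ℕ.* a ℕ.+ b ℕ.* b ℕ.+ c ℕ.* c ℕ.+ d ℕ.* d ≡ n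
  lagrange n with FourSquares-ℕ n
  ... | x , ‖x‖²≡n =
    ∣ x₀ x ∣ , ∣ x₁ x ∣ , ∣ x₂ x ∣ , ∣ x₃ x ∣ , ℤₚ.+-injective (trans (sym (‖‖²≡+‖‖ℕ² x)) ‖x‖²≡n)

module Representations where
  open import Data.Nat
  open import Data.Nat.Properties
  open import Data.Nat.Tactic.RingSolver using (solve-∀)
  open import Data.Bool using (T; true; false)
  open import Data.List using (List; []; _∷_; map; filter; length; upTo; _++_; [_]; _∷ʳ_; concatMap)
  open import Data.List.Properties
    using (upTo-∷ʳ; concatMap-++; filter-++; length-++; ++-identityʳ; filter-accept; filter-reject; length-filter)
  open import Data.List.Relation.Unary.All as All using (All; []; _∷_)
  open import Data.List.Relation.Unary.All.Properties using (++⁺; all-filter)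
  open import Data.List.Relation.Unary.AllPairs using (AllPairs; []; _∷_)
  open import Data.List.Relation.Unary.Linked.Properties using (Linked⇒AllPairs)
  open import Data.List.Relation.Binary.Permutation.Propositional using (_↭_; ↭-sym)
  open import Data.List.Relation.Binary.Permutation.Propositional.Properties using (All-resp-↭; ↭-length; map⁺)
  open import Relation.Binary.Construct.Flip.EqAndOrd using (decTotalOrder)
  open import Data.List.Sort (decTotalOrder ≤-decTotalOrder) using (sort; sort-↭; sort-↗)
  open import Data.Nat.ListAction using (sum)
  open import Data.Nat.ListAction.Properties using (sum-↭)
  open import Data.Product using (∃-syntax; _×_; _,_; proj₁; proj₂)
  open import Data.Sum using (inj₁; inj₂)
  open import Function using (_∘_)
  open import Relation.Nullary using (yes; no; ¬?)
  open import Relation.Nullary.Decidable using (from-yes)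
  open import Relation.Nullary.Negation using (contradiction)
  open import Relation.Nullary.Reflects using (ofʸ; ofⁿ)
  open import Relation.Binary.PropositionalEquality hiding ([_])
  open Arithmetic using (m≤m*m; m*m≤n*n⇒m≤n; m*m<n*n⇒m<n; ⌊√⌋-exists; αq+β≤q²)
  open Lagrange using (lagrange)

  -- reps j m n counts the ways to write n as a sum of j squares of integers in [1, m], up to order, and
  -- repsTop j k n the ways to write n as a sum of j + 1 positive squares with largest part k.
  reps : ℕ → ℕ → ℕ → ℕ
  repsTop : ℕ → ℕ → ℕ → ℕ

  reps zero    _       zero    = 1
  reps zero    _       (suc _) = 0
  reps (suc j) zero    _       = 0
  reps (suc j) (suc m) n       = repsTop j (suc m) n + reps (suc j) m n

  repsTop j k n with k * k ≤ᵇ n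
  ... | true  = reps j k (n ∸ k * k)
  ... | false = 0

  repsTop-≤ : ∀ j k {n} → k * k ≤ n → repsTop j k n ≡ reps j k (n ∸ k * k)
  repsTop-≤ j k {n} k²≤n with k * k ≤ᵇ n | ≤ᵇ-reflects-≤ (k * k) n
  ... | true  | _        = refl
  ... | false | ofⁿ k²≰n = contradiction k²≤n k²≰n

  repsTop-> : ∀ j k {n} → n < k * k → repsTop j k n ≡ 0
  repsTop-> j k {n} n<k² with k * k ≤ᵇ n | ≤ᵇ-reflects-≤ (k * k) n
  ... | true  | ofʸ k²≤n = contradiction k²≤n (<⇒≱ n<k²)
  ... | false | _        = refl

  count : ℕ → List (List ℕ) → ℕ
  count n = length ∘ filter (λ xs → sumSq xs ≟ n)

  count-++ : ∀ n xss yss → count n (xss ++ yss) ≡ count n xss + count n yss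
  count-++ n xss yss = trans (cong length (filter-++ (λ xs → sumSq xs ≟ n) xss yss)) (length-++ (filter _ xss))

  count-∷-≡ : ∀ {n} xs xss → sumSq xs ≡ n → count n (xs ∷ xss) ≡ suc (count n xss)
  count-∷-≡ {n} xs xss eq = cong length (filter-accept (λ ys → sumSq ys ≟ n) {xs} {xss} eq)

  count-∷-≢ : ∀ {n} xs xss → sumSq xs ≢ n → count n (xs ∷ xss) ≡ count n xss
  count-∷-≢ {n} xs xss neq = cong length (filter-reject (λ ys → sumSq ys ≟ n) {xs} {xss} neq)

  count-map-∷ : ∀ {k n} → k * k ≤ n → ∀ xss → count n (map (k ∷_) xss) ≡ count (n ∸ k * k) xss
  count-map-∷ _ [] = refl
  count-map-∷ {k} {n} k²≤n (xs ∷ xss) with sumSq xs ≟ n ∸ k * k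
  ... | yes eq = trans (count-∷-≡ (k ∷ xs) (map (k ∷_) xss) (trans (cong (k * k +_) eq) (m+[n∸m]≡n k²≤n)))
                       (trans (cong suc (count-map-∷ k²≤n xss)) (sym (count-∷-≡ xs xss eq)))
  ... | no neq = trans (count-∷-≢ (k ∷ xs) (map (k ∷_) xss) (neq ∘ λ eq → trans (sym (m+n∸m≡n (k * k) (sumSq xs)))
                                                                                   (cong (_∸ k * k) eq)))
                       (trans (count-map-∷ k²≤n xss) (sym (count-∷-≢ xs xss neq)))

  count-map-∷-> : ∀ {k n} → n < k * k → ∀ xss → count n (map (k ∷_) xss) ≡ 0
  count-map-∷-> _ [] = refl
  count-map-∷-> {k} {n} n<k² (xs ∷ xss) =
    trans (count-∷-≢ (k ∷ xs) (map (k ∷_) xss) (λ eq → <⇒≱ n<k² (subst (k * k ≤_) eq (m≤m+n (k * k) (sumSq xs)))))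
          (count-map-∷-> n<k² xss)

  count-decLists : ∀ j m n → count n (decLists j m) ≡ reps j m n
  count-decLists zero    m zero    = refl
  count-decLists zero    m (suc n) = refl
  count-decLists (suc j) zero n    = refl
  count-decLists (suc j) (suc m) n = begin
    count n (concatMap F (upTo (suc m)))                 ≡⟨ cong (count n ∘ concatMap F) (upTo-∷ʳ m) ⟨
    count n (concatMap F (upTo m ∷ʳ m))                  ≡⟨ cong (count n) (concatMap-++ F (upTo m) [ m ]) ⟩
    count n (concatMap F (upTo m) ++ F m ++ [])          ≡⟨ count-++ n (concatMap F (upTo m)) (F m ++ []) ⟩
    count n (decLists (suc j) m) + count n (F m ++ [])   ≡⟨ cong₂ _+_ (count-decLists (suc j) m n)
                                                                      (cong (count n) (++-identityʳ (F m))) ⟩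
    reps (suc j) m n + count n (F m)                     ≡⟨ +-comm (reps (suc j) m n) (count n (F m)) ⟩
    count n (F m) + reps (suc j) m n                     ≡⟨ cong (_+ reps (suc j) m n) top ⟩
    repsTop j (suc m) n + reps (suc j) m n               ∎
    where
    open ≡-Reasoning
    F : ℕ → List (List ℕ)
    F k = map (suc k ∷_) (decLists j (suc k))
    top : count n (F m) ≡ repsTop j (suc m) n
    top with ≤-<-connex (suc m * suc m) n
    ... | inj₁ k²≤n = trans (count-map-∷ k²≤n (decLists j (suc m)))
                            (trans (count-decLists j (suc m) _) (sym (repsTop-≤ j (suc m) k²≤n)))
    ... | inj₂ n<k² = trans (count-map-∷-> n<k² (decLists j (suc m))) (sym (repsTop-> j (suc m) n<k²))

  p2≡reps : ∀ n j → p2 n j ≡ reps j n n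
  p2≡reps n j = count-decLists j n n

  reps-mono : ∀ j n {m m′} → m ≤ m′ → reps j m n ≤ reps j m′ n
  reps-mono zero    zero    _ = ≤-refl
  reps-mono zero    (suc _) _ = ≤-refl
  reps-mono (suc j) n {m′ = zero}   z≤n = ≤-refl
  reps-mono (suc j) n {m} {suc m′} m≤1+m′ with m≤n⇒m<n∨m≡n m≤1+m′
  ... | inj₁ m<1+m′ = ≤-trans (reps-mono (suc j) n (≤-pred m<1+m′)) (m≤n+m (reps (suc j) m′ n) (repsTop j (suc m′) n))
  ... | inj₂ refl   = ≤-refl

  reps-saturated : ∀ j n {s m} → s ≤ m → n < suc s * suc s → reps j m n ≡ reps j s n
  reps-saturated zero    zero    _ _ = refl
  reps-saturated zero    (suc _) _ _ = refl
  reps-saturated (suc j) n s≤m n<[1+s]² with m≤n⇒m<n∨m≡n s≤m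
  ... | inj₂ refl = refl
  ... | inj₁ s<m@(s≤s s≤m′) =
    cong₂ _+_ (repsTop-> j _ (<-≤-trans n<[1+s]² (*-mono-≤ s<m s<m))) (reps-saturated (suc j) n s≤m′ n<[1+s]²)

  reps-vanishes : ∀ j m n → j * (m * m) < n → reps j m n ≡ 0
  reps-vanishes zero    m       (suc n) _      = refl
  reps-vanishes (suc j) zero    n       _      = refl
  reps-vanishes (suc j) (suc m) n       jk²<n  =
    cong₂ _+_ top (reps-vanishes (suc j) m n (≤-<-trans (*-monoʳ-≤ (suc j) (*-mono-≤ (n≤1+n m) (n≤1+n m))) jk²<n))
    where
    k = suc m
    top : repsTop j k n ≡ 0
    top with ≤-<-connex (k * k) n
    ... | inj₂ n<k² = repsTop-> j k n<k²
    ... | inj₁ k²≤n = trans (repsTop-≤ j k k²≤n) (reps-vanishes j k (n ∸ k * k)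
                        (m+n≤o⇒m≤o∸n (suc (j * (k * k))) (subst (_≤ n) (cong suc (+-comm (k * k) (j * (k * k)))) jk²<n)))

  repsTop≤reps : ∀ j n {k m} → 0 < k → k ≤ m → repsTop j k n ≤ reps (suc j) m n
  repsTop≤reps j n {suc k} _ k≤m = ≤-trans (m≤m+n (repsTop j (suc k) n) (reps (suc j) k n)) (reps-mono (suc j) n k≤m)

  reps-range : ∀ {j n t} m I → (∀ {k} → m < k → k ≤ m + I → t ≤ repsTop j k n) → I * t ≤ reps (suc j) (m + I) n
  reps-range m zero    _     = z≤n
  reps-range m (suc I) bound rewrite +-suc m I =
    +-mono-≤ (bound (s≤s (m≤m+n m I)) ≤-refl) (reps-range m I λ m<k k≤m+I → bound m<k (m≤n⇒m≤1+n k≤m+I))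

  reps-pos : ∀ {m} xs → AllPairs _≥_ xs → All (λ x → 0 < x × x ≤ m) xs → 1 ≤ reps (length xs) m (sumSq xs)
  reps-pos []       _                 _                         = ≤-refl
  reps-pos {m} (x ∷ xs) (x≥xs ∷ sorted) ((0<x , x≤m) ∷ bounds) = begin
    1                                              ≤⟨ reps-pos xs sorted
                                                          (All.zipWith (λ ((0<y , _) , y≤x) → 0<y , y≤x) (bounds , x≥xs)) ⟩
    reps (length xs) x (sumSq xs)                  ≡⟨ cong (reps (length xs) x) (m+n∸m≡n (x * x) (sumSq xs)) ⟨
    reps (length xs) x (x * x + sumSq xs ∸ x * x)  ≡⟨ repsTop-≤ (length xs) x (m≤m+n (x * x) (sumSq xs)) ⟨
    repsTop (length xs) x (x * x + sumSq xs)       ≤⟨ repsTop≤reps (length xs) (x * x + sumSq xs) 0<x x≤m ⟩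
    reps (suc (length xs)) m (sumSq (x ∷ xs))      ∎
    where open ≤-Reasoning

  sumSq≡sum : ∀ xs → sumSq xs ≡ sum (map (λ x → x * x) xs)
  sumSq≡sum []       = refl
  sumSq≡sum (x ∷ xs) = cong (x * x +_) (sumSq≡sum xs)

  sumSq-↭ : ∀ {xs ys} → xs ↭ ys → sumSq xs ≡ sumSq ys
  sumSq-↭ {xs} {ys} xs↭ys = trans (sumSq≡sum xs) (trans (sum-↭ (map⁺ _ xs↭ys)) (sym (sumSq≡sum ys)))

  reps-pos-unsorted : ∀ {m} xs → All (λ x → 0 < x × x ≤ m) xs → 1 ≤ reps (length xs) m (sumSq xs)
  reps-pos-unsorted {m} xs bounds =
    subst₂ (λ l s → 1 ≤ reps l m s) (↭-length (sort-↭ xs)) (sumSq-↭ (sort-↭ xs))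
      (reps-pos (sort xs) (Linked⇒AllPairs (λ y≤x z≤y → ≤-trans z≤y y≤x) (sort-↗ xs))
                (All-resp-↭ (↭-sym (sort-↭ xs)) bounds))

  -- Sums of five positive squares

  sumSq-++ : ∀ xs ys → sumSq (xs ++ ys) ≡ sumSq xs + sumSq ys
  sumSq-++ []       ys = refl
  sumSq-++ (x ∷ xs) ys = trans (cong (x * x +_) (sumSq-++ xs ys)) (sym (+-assoc (x * x) (sumSq xs) (sumSq ys)))

  sumSq-filter-pos : ∀ xs → sumSq (filter (0 <?_) xs) ≡ sumSq xs
  sumSq-filter-pos []           = refl
  sumSq-filter-pos (zero  ∷ xs) = sumSq-filter-pos xs
  sumSq-filter-pos (suc x ∷ xs) = cong (suc x * suc x +_) (sumSq-filter-pos xs)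

  sq≤sumSq : ∀ xs → All (λ x → x * x ≤ sumSq xs) xs
  sq≤sumSq []       = []
  sq≤sumSq (x ∷ xs) = m≤m+n (x * x) (sumSq xs) ∷ All.map (λ le → ≤-trans le (m≤n+m (sumSq xs) (x * x))) (sq≤sumSq xs)

  -- 169 = 13² = 12² + 5² = 12² + 4² + 3² = 10² + 8² + 2² + 1² = 12² + 4² + 2² + 2² + 1², so padding l
  -- completes any l ≤ 4 positive squares to exactly five.
  padding : ℕ → List ℕ
  padding 0 = 12 ∷ 4 ∷ 2 ∷ 2 ∷ 1 ∷ []
  padding 1 = 10 ∷ 8 ∷ 2 ∷ 1 ∷ []
  padding 2 = 12 ∷ 4 ∷ 3 ∷ []
  padding 3 = 12 ∷ 5 ∷ []
  padding _ = 13 ∷ []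

  padding-spec : ∀ l → l ≤ 4 → l + length (padding l) ≡ 5 × All (0 <_) (padding l) × sumSq (padding l) ≡ 169
  padding-spec 0 _ = refl , z<s ∷ z<s ∷ z<s ∷ z<s ∷ z<s ∷ [] , refl
  padding-spec 1 _ = refl , z<s ∷ z<s ∷ z<s ∷ z<s ∷ [] , refl
  padding-spec 2 _ = refl , z<s ∷ z<s ∷ z<s ∷ [] , refl
  padding-spec 3 _ = refl , z<s ∷ z<s ∷ [] , refl
  padding-spec 4 _ = refl , z<s ∷ [] , refl
  padding-spec (suc (suc (suc (suc (suc _))))) (s≤s (s≤s (s≤s (s≤s ()))))

  sumOfFivePositiveSquares : ∀ r → 169 ≤ r → ∃[ xs ] length xs ≡ 5 × All (0 <_) xs × sumSq xs ≡ r
  sumOfFivePositiveSquares r 169≤r with lagrange (r ∸ 169)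
  ... | a , b , c , d , a²+b²+c²+d²≡r∸169 =
    ps ++ padding (length ps) , trans (length-++ ps) l+pad≡5 , ++⁺ (all-filter (0 <?_) abcd) pad-pos , (begin
      sumSq (ps ++ padding (length ps))        ≡⟨ sumSq-++ ps (padding (length ps)) ⟩
      sumSq ps + sumSq (padding (length ps))   ≡⟨ cong₂ _+_ (sumSq-filter-pos abcd) pad-sum ⟩
      sumSq abcd + 169                         ≡⟨ cong (_+ 169) (trans (regroup a b c d) a²+b²+c²+d²≡r∸169) ⟩
      r ∸ 169 + 169                            ≡⟨ m∸n+n≡m 169≤r ⟩
      r                                        ∎)
    where
    open ≡-Reasoning
    abcd = a ∷ b ∷ c ∷ d ∷ []
    ps = filter (0 <?_) abcd
    regroup : ∀ a b c d → a * a + (b * b + (c * c + (d * d + 0))) ≡ a * a + b * b + c * c + d * d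
    regroup = solve-∀
    spec = padding-spec (length ps) (length-filter (0 <?_) abcd)
    l+pad≡5 = proj₁ spec
    pad-pos = proj₁ (proj₂ spec)
    pad-sum = proj₂ (proj₂ spec)

  reps₅-small : ∀ {r} → 34 ≤ r → r < 169 → 1 ≤ reps 5 13 r
  reps₅-small {r} 34≤r r<169 = subst (λ t → 1 ≤ reps 5 13 t) (m+[n∸m]≡n 34≤r) (checked (∸-monoˡ-< r<169 34≤r))
    where
    checked : ∀ {i} → i < 135 → 1 ≤ reps 5 13 (34 + i)
    checked = from-yes (allUpTo? (λ i → 1 ≤? reps 5 13 (34 + i)) 135)

  reps₅-pos : ∀ {b r} → 34 ≤ r → r ≤ b * b → 1 ≤ reps 5 b r
  reps₅-pos {b} {r} 34≤r r≤b² with r <? 169 | 13 ≤? b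
  ... | yes r<169 | yes 13≤b = ≤-trans (reps₅-small 34≤r r<169) (reps-mono 5 r 13≤b)
  ... | yes r<169 | no  13≰b =
    subst (1 ≤_) (reps-saturated 5 r (<⇒≤ (≰⇒> 13≰b)) (≤-<-trans r≤b² (*-mono-< (n<1+n b) (n<1+n b))))
                 (reps₅-small 34≤r r<169)
  ... | no  r≮169 | _ = fromList (sumOfFivePositiveSquares r (≮⇒≥ r≮169))
    where
    fromList : (∃[ xs ] length xs ≡ 5 × All (0 <_) xs × sumSq xs ≡ r) → 1 ≤ reps 5 b r
    fromList (xs , len≡5 , pos , sumSq≡r) = subst₂ (λ l t → 1 ≤ reps l b t) len≡5 sumSq≡r (reps-pos-unsorted xs bounds)
      where
      bounds : All (λ x → 0 < x × x ≤ b) xs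
      bounds = All.zipWith (λ (0<x , x²≤Σ) → 0<x , m*m≤n*n⇒m≤n (≤-trans x²≤Σ (subst (_≤ b * b) (sym sumSq≡r) r≤b²)))
                           (pos , sq≤sumSq xs)

  -- n ≥ 4900

  module SevenSquares {n q e : ℕ} (35≤q : 35 ≤ q)
    (4q²≤n : 4 * (q * q) ≤ n) (n<4[q+1]² : n < 4 * (suc q * suc q))
    (e²+2q²≤n : e * e + 2 * (q * q) ≤ n) (n<[e+1]²+2q² : n < suc e * suc e + 2 * (q * q)) where

    private
      instance
        q≢0 : NonZero q
        q≢0 = >-nonZero (<-≤-trans z<s 35≤q)

      dominated : ∀ α β → T (α ≤ᵇ 35 + 35) → T (α * 35 + β ≤ᵇ 35 * 35) → α * q + β ≤ q * q
      dominated α β α≤70 bound = αq+β≤q² (≤ᵇ⇒≤ α 70 α≤70) (≤ᵇ⇒≤ (α * 35 + β) 1225 bound) 35≤q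

    2e<3q : 2 * e < 3 * q
    2e<3q = m*m<n*n⇒m<n (+-cancelʳ-< (8 * (q * q)) (2 * e * (2 * e)) (3 * q * (3 * q)) (begin-strict
      2 * e * (2 * e) + 8 * (q * q)   ≡⟨ expand₁ e q ⟩
      4 * (e * e + 2 * (q * q))       ≤⟨ *-monoʳ-≤ 4 e²+2q²≤n ⟩
      4 * n                           <⟨ *-monoʳ-< 4 n<4[q+1]² ⟩
      4 * (4 * (suc q * suc q))       ≡⟨ expand₂ q ⟩
      32 * q + 16 + 16 * (q * q)      ≤⟨ +-monoˡ-≤ (16 * (q * q)) (dominated 32 16 _ _) ⟩
      q * q + 16 * (q * q)            ≡⟨ expand₃ q ⟩
      3 * q * (3 * q) + 8 * (q * q)   ∎))
      where
      open ≤-Reasoning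
      expand₁ : ∀ e q → 2 * e * (2 * e) + 8 * (q * q) ≡ 4 * (e * e + 2 * (q * q))
      expand₁ = solve-∀
      expand₂ : ∀ q → 4 * (4 * (suc q * suc q)) ≡ 32 * q + 16 + 16 * (q * q)
      expand₂ = solve-∀
      expand₃ : ∀ q → q * q + 16 * (q * q) ≡ 3 * q * (3 * q) + 8 * (q * q)
      expand₃ = solve-∀

    corner≤n : (e + 5) * (e + 5) + (q + 8) * (q + 8) + 34 ≤ n
    corner≤n = begin
      (e + 5) * (e + 5) + (q + 8) * (q + 8) + 34         ≡⟨ expand₁ e q ⟩
      e * e + q * q + (5 * (1 + 2 * e) + 16 * q + 118)   ≤⟨ +-monoʳ-≤ (e * e + q * q)
                                                              (+-monoˡ-≤ 118 (+-monoˡ-≤ (16 * q) (*-monoʳ-≤ 5 2e<3q))) ⟩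
      e * e + q * q + (5 * (3 * q) + 16 * q + 118)       ≡⟨ cong (e * e + q * q +_) (expand₂ q) ⟩
      e * e + q * q + (31 * q + 118)                     ≤⟨ +-monoʳ-≤ (e * e + q * q) (dominated 31 118 _ _) ⟩
      e * e + q * q + q * q                              ≡⟨ expand₃ e q ⟩
      e * e + 2 * (q * q)                                ≤⟨ e²+2q²≤n ⟩
      n                                                  ∎
      where
      open ≤-Reasoning
      expand₁ : ∀ e q → (e + 5) * (e + 5) + (q + 8) * (q + 8) + 34 ≡ e * e + q * q + (5 * (1 + 2 * e) + 16 * q + 118)
      expand₁ = solve-∀
      expand₂ : ∀ q → 5 * (3 * q) + 16 * q + 118 ≡ 31 * q + 118
      expand₂ = solve-∀
      expand₃ : ∀ e q → e * e + q * q + q * q ≡ e * e + 2 * (q * q)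
      expand₃ = solve-∀

    q+8≤e : q + 8 ≤ e
    q+8≤e = ≤-pred (m*m<n*n⇒m<n (begin-strict
      (q + 8) * (q + 8)     ≡⟨ expand₁ q ⟩
      16 * q + 64 + q * q   ≤⟨ +-monoˡ-≤ (q * q) (dominated 16 64 _ _) ⟩
      q * q + q * q         ≡⟨ expand₂ q ⟩
      2 * (q * q)           <⟨ +-cancelʳ-< (2 * (q * q)) (2 * (q * q)) (suc e * suc e) 4q²<[e+1]²+2q² ⟩
      suc e * suc e         ∎))
      where
      open ≤-Reasoning
      expand₁ : ∀ q → (q + 8) * (q + 8) ≡ 16 * q + 64 + q * q
      expand₁ = solve-∀
      expand₂ : ∀ q → q * q + q * q ≡ 2 * (q * q)
      expand₂ = solve-∀
      4q²<[e+1]²+2q² : 2 * (q * q) + 2 * (q * q) < suc e * suc e + 2 * (q * q)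
      expand₃ : ∀ q → 4 * (q * q) ≡ 2 * (q * q) + 2 * (q * q)
      expand₃ = solve-∀
      4q²<[e+1]²+2q² = subst (_< suc e * suc e + 2 * (q * q)) (expand₃ q) (≤-<-trans 4q²≤n n<[e+1]²+2q²)

    module _ {a b : ℕ} (e<a : e < a) (a≤e+5 : a ≤ e + 5) (q≤b : q ≤ b) (b≤q+8 : b ≤ q + 8) where

      a²+b²+34≤n : a * a + b * b + 34 ≤ n
      a²+b²+34≤n = ≤-trans (+-monoˡ-≤ 34 (+-mono-≤ (*-mono-≤ a≤e+5 a≤e+5) (*-mono-≤ b≤q+8 b≤q+8))) corner≤n

      n≤a²+b²+b² : n ≤ a * a + b * b + b * b
      n≤a²+b²+b² = <⇒≤ (begin-strict
        n                             <⟨ n<[e+1]²+2q² ⟩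
        suc e * suc e + 2 * (q * q)   ≤⟨ +-mono-≤ (*-mono-≤ e<a e<a) (*-monoʳ-≤ 2 (*-mono-≤ q≤b q≤b)) ⟩
        a * a + 2 * (b * b)           ≡⟨ expand a b ⟩
        a * a + b * b + b * b         ∎)
        where
        open ≤-Reasoning
        expand : ∀ a b → a * a + 2 * (b * b) ≡ a * a + b * b + b * b
        expand = solve-∀

      1≤repsTop₅ : 1 ≤ repsTop 5 b (n ∸ a * a)
      1≤repsTop₅ = subst (1 ≤_) (sym (repsTop-≤ 5 b b²≤n∸a²)) (reps₅-pos {b} 34≤r r≤b²)
        where
        a²+b²≤n = ≤-trans (m≤m+n (a * a + b * b) 34) a²+b²+34≤n
        b²≤n∸a² : b * b ≤ n ∸ a * a
        b²≤n∸a² = m+n≤o⇒m≤o∸n (b * b) (subst (_≤ n) (+-comm (a * a) (b * b)) a²+b²≤n)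
        34≤r : 34 ≤ n ∸ a * a ∸ b * b
        34≤r = subst (34 ≤_) (sym (∸-+-assoc n (a * a) (b * b)))
                 (m+n≤o⇒m≤o∸n 34 (subst (_≤ n) (+-comm (a * a + b * b) 34) a²+b²+34≤n))
        r≤b² : n ∸ a * a ∸ b * b ≤ b * b
        r≤b² = subst (_≤ b * b) (sym (∸-+-assoc n (a * a) (b * b))) (m≤n+o⇒m∸n≤o n (a * a + b * b) n≤a²+b²+b²)

    9≤repsTop₆ : ∀ {a} → e < a → a ≤ e + 5 → 9 ≤ repsTop 6 a n
    9≤repsTop₆ {a} e<a a≤e+5 = subst (9 ≤_) (sym (repsTop-≤ 6 a a²≤n)) (begin
      9 * 1                             ≤⟨ reps-range (pred q) 9 (λ {b} q-1<b b≤q-1+9 →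
                                             1≤repsTop₅ e<a a≤e+5 (subst (_≤ b) (suc-pred q) q-1<b) (subst (b ≤_) q-1+9≡q+8 b≤q-1+9)) ⟩
      reps 6 (pred q + 9) (n ∸ a * a)   ≤⟨ reps-mono 6 (n ∸ a * a)
                                             (subst (_≤ a) (sym q-1+9≡q+8) (≤-trans q+8≤e (<⇒≤ e<a))) ⟩
      reps 6 a (n ∸ a * a)              ∎)
      where
      open ≤-Reasoning
      a²≤n = ≤-trans (m≤m+n (a * a) _) (≤-trans (m≤m+n _ 34) (a²+b²+34≤n e<a a≤e+5 ≤-refl (m≤m+n q 8)))
      q-1+9≡q+8 : pred q + 9 ≡ q + 8
      q-1+9≡q+8 = trans (+-suc (pred q) 8) (cong (_+ 8) (suc-pred q))

    45≤reps₇ : 45 ≤ reps 7 n n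
    45≤reps₇ = begin
      5 * 9              ≤⟨ reps-range e 5 9≤repsTop₆ ⟩
      reps 7 (e + 5) n   ≤⟨ reps-mono 7 n e+5≤n ⟩
      reps 7 n n         ∎
      where
      open ≤-Reasoning
      e+5≤n = ≤-trans (m≤m*m (e + 5)) (≤-trans (m≤m+n _ _) (≤-trans (m≤m+n _ 34) corner≤n))

  45≤reps₇-above-4900 : ∀ {n} → 4900 ≤ n → 45 ≤ reps 7 n n
  45≤reps₇-above-4900 {n} 4900≤n with ⌊√⌋-exists 4 n
  ... | q , 4q²≤n , n<4[q+1]² with ⌊√⌋-exists 1 (n ∸ 2 * (q * q))
  ...   | e , e²≤n∸2q² , n∸2q²<[e+1]² =
    SevenSquares.45≤reps₇ {n} {q} {e} 35≤q 4q²≤n n<4[q+1]² e²+2q²≤n n<[e+1]²+2q²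
    where
    35≤q : 35 ≤ q
    35≤q = ≮⇒≥ (λ q<35 → <⇒≱ (<-≤-trans n<4[q+1]² (*-monoʳ-≤ 4 (*-mono-≤ q<35 q<35))) 4900≤n)
    2q²≤n : 2 * (q * q) ≤ n
    2q²≤n = ≤-trans (*-monoˡ-≤ (q * q) {2} {4} (s≤s (s≤s z≤n))) 4q²≤n
    e²+2q²≤n : e * e + 2 * (q * q) ≤ n
    e²+2q²≤n = subst (e * e + 2 * (q * q) ≤_) (m∸n+n≡m 2q²≤n)
                 (+-monoˡ-≤ (2 * (q * q)) (subst (_≤ n ∸ 2 * (q * q)) (*-identityˡ (e * e)) e²≤n∸2q²))
    n<[e+1]²+2q² : n < suc e * suc e + 2 * (q * q)
    n<[e+1]²+2q² = subst (_< suc e * suc e + 2 * (q * q)) (m∸n+n≡m 2q²≤n)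
                     (+-monoˡ-< (2 * (q * q)) (subst (n ∸ 2 * (q * q) <_) (*-identityˡ (suc e * suc e)) n∸2q²<[e+1]²))

  -- n < 4900

  ⊓-+-∸ : ∀ c a b → c ⊓ a + (c ∸ c ⊓ a) ⊓ b ≡ c ⊓ (a + b)
  ⊓-+-∸ c a b with ≤-total a c
  ... | inj₁ a≤c rewrite m≥n⇒m⊓n≡n a≤c = trans (+-distribˡ-⊓ a (c ∸ a) b) (cong (_⊓ (a + b)) (m+[n∸m]≡n a≤c))
  ... | inj₂ c≤a rewrite m≤n⇒m⊓n≡m c≤a | n∸n≡0 c =
    trans (+-identityʳ c) (sym (m≤n⇒m⊓n≡m (≤-trans c≤a (m≤m+n a b))))

  repsUpTo : ℕ → ℕ → ℕ → ℕ → ℕ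
  repsUpTo zero    j       m       n = 0
  repsUpTo (suc c) zero    m       n = reps zero m n
  repsUpTo (suc c) (suc j) zero    n = 0
  repsUpTo (suc c) (suc j) (suc m) n with suc j * (suc m * suc m) <ᵇ n
  ... | true  = 0
  ... | false with suc m * suc m ≤ᵇ n
  ...   | false = repsUpTo (suc c) (suc j) m n
  ...   | true  = withTop (repsUpTo (suc c) j (suc m) (n ∸ suc m * suc m))
    where
    -- a function rather than a let, so that the count of the top summand is evaluated only once
    withTop : ℕ → ℕ
    withTop t = t + repsUpTo (suc c ∸ t) (suc j) m n

  repsUpTo≡⊓reps : ∀ c j m n → repsUpTo c j m n ≡ c ⊓ reps j m n
  repsUpTo≡⊓reps zero    j       m       n       = refl
  repsUpTo≡⊓reps (suc c) zero    m       zero    = cong suc (sym (⊓-zeroʳ c))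
  repsUpTo≡⊓reps (suc c) zero    m       (suc n) = refl
  repsUpTo≡⊓reps (suc c) (suc j) zero    n       = refl
  repsUpTo≡⊓reps (suc c) (suc j) (suc m) n with suc j * (suc m * suc m) <ᵇ n | <ᵇ-reflects-< (suc j * (suc m * suc m)) n
  ... | true  | ofʸ jk²<n = sym (trans (cong (suc c ⊓_) (reps-vanishes (suc j) (suc m) n jk²<n)) (⊓-zeroʳ (suc c)))
  ... | false | _ with suc m * suc m ≤ᵇ n
  ...   | false = repsUpTo≡⊓reps (suc c) (suc j) m n
  ...   | true  = begin
    t + repsUpTo (suc c ∸ t) (suc j) m n        ≡⟨ cong₂ _+_ t≡ (repsUpTo≡⊓reps (suc c ∸ t) (suc j) m n) ⟩
    suc c ⊓ A + (suc c ∸ t) ⊓ B                 ≡⟨ cong (λ u → suc c ⊓ A + (suc c ∸ u) ⊓ B) t≡ ⟩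
    suc c ⊓ A + (suc c ∸ suc c ⊓ A) ⊓ B         ≡⟨ ⊓-+-∸ (suc c) A B ⟩
    suc c ⊓ (A + B)                             ∎
    where
    open ≡-Reasoning
    A = reps j (suc m) (n ∸ suc m * suc m)
    B = reps (suc j) m n
    t = repsUpTo (suc c) j (suc m) (n ∸ suc m * suc m)
    t≡ : t ≡ suc c ⊓ A
    t≡ = repsUpTo≡⊓reps (suc c) j (suc m) (n ∸ suc m * suc m)

  isqrt≤ : ℕ → ℕ → ℕ
  isqrt≤ zero    n = 0
  isqrt≤ (suc b) n with suc b * suc b ≤ᵇ n
  ... | true  = suc b
  ... | false = isqrt≤ b n

  isqrt≤-spec : ∀ b n → n < suc b * suc b → isqrt≤ b n * isqrt≤ b n ≤ n × n < suc (isqrt≤ b n) * suc (isqrt≤ b n)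
  isqrt≤-spec zero    n n<1 = z≤n , n<1
  isqrt≤-spec (suc b) n n<[b+2]² with suc b * suc b ≤ᵇ n | ≤ᵇ-reflects-≤ (suc b * suc b) n
  ... | true  | ofʸ [b+1]²≤n = [b+1]²≤n , n<[b+2]²
  ... | false | ofⁿ [b+1]²≰n = isqrt≤-spec b n (≰⇒> [b+1]²≰n)

  reps₇≢44-below-4900 : ∀ {n} → n < 4900 → reps 7 n n ≢ 44
  reps₇≢44-below-4900 {n} n<4900 reps≡44 = checked n<4900 (begin
    repsUpTo 45 7 s n   ≡⟨ repsUpTo≡⊓reps 45 7 s n ⟩
    45 ⊓ reps 7 s n     ≡⟨ cong (45 ⊓_) (reps-saturated 7 n s≤n n<[s+1]²) ⟨
    45 ⊓ reps 7 n n     ≡⟨ cong (45 ⊓_) reps≡44 ⟩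
    44                  ∎)
    where
    open ≡-Reasoning
    checked : ∀ {n} → n < 4900 → repsUpTo 45 7 (isqrt≤ 70 n) n ≢ 44
    checked = from-yes (allUpTo? (λ n → ¬? (repsUpTo 45 7 (isqrt≤ 70 n) n ≟ 44)) 4900)
    s = isqrt≤ 70 n
    spec = isqrt≤-spec 70 n (<-trans n<4900 (≤ᵇ⇒≤ 4901 (71 * 71) _))
    s≤n = ≤-trans (m≤m*m s) (proj₁ spec)
    n<[s+1]² = proj₂ spec

  reps₇≢44 : ∀ n → reps 7 n n ≢ 44
  reps₇≢44 n with ≤-<-connex 4900 n
  ... | inj₁ 4900≤n = <⇒≢ (45≤reps₇-above-4900 4900≤n) ∘ sym
  ... | inj₂ n<4900 = reps₇≢44-below-4900 n<4900

open Representations using (p2≡reps; reps₇≢44)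

theorem6p5 : (n : ℕ) → p2 (suc n) 7 ≢ 44
theorem6p5 n p2≡44 = reps₇≢44 (suc n) (trans (sym (p2≡reps (suc n) 7)) p2≡44)
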